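{- Let $\mathcal M=(W,\preccurlyeq,S,V)$ be an intuitionistic dynamic model, let $\Sigma$ be a finite set of formulas closed under subformulas, and let $\mathcal A=(W_{\mathcal A},\preccurlyeq_{\mathcal A},\lambda)$ be a $2^\Sigma$-labeled poset. If $\mathcal A\ll\mathcal M$, i.e. there is a condensation from $\mathcal M^\Sigma$ to $\mathcal A$, then $\mathcal A$ is a $\Sigma$-quasimodel.
   Context: Formulas: $\varphi::= p\mid\bot\mid\varphi\wedge\varphi\mid\varphi\vee\varphi\mid\varphi\to\varphi\mid\bigcirc\varphi\mid\Diamond\varphi\mid\Box\varphi$, $p$ in a countable set $\mathbb P$. An intuitionistic dynamic model is $(W,\preccurlyeq,S,V)$ with $W\ne\emptyset$, $\preccurlyeq$ a partial order, $S\colon W\to W$ with $w\preccurlyeq v\Rightarrow S(w)\preccurlyeq S(v)$, $V\colon W\to2^{\mathbb P}$ with $w\preccurlyeq v\Rightarrow V(w)\subseteq V(v)$; satisfaction (with $S^0(w)=w$, $S^{k+1}(w)=S(S^k(w))$): $w\models p$ iff $p\in V(w)$; $\bot$ never; $\wedge,\vee$ as usual; $w\models\varphi\to\psi$ iff for all $v\succcurlyeq w$, $v\models\varphi$ implies $v\models\psi$; $w\models\bigcirc\varphi$ iff $S(w)\models\varphi$; $w\models\Diamond\varphi$ iff $S^k(w)\models\varphi$ for some $k$; $w\models\Box\varphi$ iff $S^k(w)\models\varphi$ for all $k$. $\Sigma(w)=\{\psi\in\Sigma\mid \mathcal M,w\models\psi\}$ and $\mathcal M^\Sigma$ is the labeled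 poset $(W,\preccurlyeq,\Sigma(\cdot))$. A labeled poset is $(W,\preccurlyeq,\lambda)$ with $(W,\preccurlyeq)$ a poset and $\lambda$ a function on $W$ (a $2^\Sigma$-labeled poset has $\lambda\colon W\to 2^\Sigma$). A simulation from $\mathcal A$ to $\mathcal B$ is $\sigma\subseteq W_{\mathcal A}\times W_{\mathcal B}$ with domain $W_{\mathcal A}$ such that $w\mathrel\sigma v$ implies $\lambda_{\mathcal A}(w)=\lambda_{\mathcal B}(v)$ and for all $w'\succcurlyeq_{\mathcal A}w$ there is $v'\succcurlyeq_{\mathcal B}v$ with $w'\mathrel\sigma v'$; an immersion is a simulation that is a function. A condensation from $\mathcal A$ to $\mathcal B$ is a pair $(\rho,\iota)$ of immersions $\rho\colon W_{\mathcal A}\to W_{\mathcal B}$ and $\iota\colon W_{\mathcal B}\to W_{\mathcal A}$ such that $\rho$ is surjective and $\rho\circ\iota$ is the identity on $W_{\mathcal B}$. A $2^\Sigma$-labeled poset $(W,\preccurlyeq,\lambda)$ is a $\Sigma$-quasimodel if $w\preccurlyeq v$ implies $\lambda(w)\subseteq\lambda(v)$, and for every $\varphi\to\psi\in\Sigma$ and $w\in W$: $\varphi\to\psi\in\lambda(w)$ iff for all $v\succcurlyeq w$, $\varphi\in\lambda(v)$ implies $\psi\in\lambda(v)$. -}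

module Defs where

open import Data.Nat using (ℕ)
open import Data.Product using (Σ; ∃; ∃-syntax; _×_; _,_)
open import Data.Empty using (⊥)
open import Data.Sum using (_⊎_)
open import Data.List using (List)
open import Data.List.Membership.Propositional using (_∈_)
open import Function.Bundles using (_⇔_)
open import Relation.Binary.PropositionalEquality using (_≡_)
open import Relation.Binary.Structures using (IsPartialOrder)

infixr 6 _∧′_
infixr 5 _∨′_
infixr 4 _⇒_
data Form : Set where
  var  : ℕ → Form
  ⊥′   : Form
  _∧′_ : Form → Form → Form
  _∨′_ : Form → Form → Form
  _⇒_  : Form → Form → Form
  ◯    : Form → Form
  ◇    : Form → Form
  □    : Form → Form

-- Intuitionistic dynamic model (W, ≼, S, V); V w p means p ∈ V(w).
record IDModel : Set₁ where
  field
    W        : Set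
    _≼_      : W → W → Set
    isPO     : IsPartialOrder _≡_ _≼_
    S        : W → W
    S-mono   : ∀ {w v} → w ≼ v → S w ≼ S v
    V        : W → ℕ → Set
    V-mono   : ∀ {w v} → w ≼ v → ∀ p → V w p → V v p

module _ (M : IDModel) where
  open IDModel M

  iter : ℕ → W → W
  iter ℕ.zero w = w
  iter (ℕ.suc k) w = S (iter k w)

  sat : W → Form → Set
  sat w (var p)   = V w p
  sat w ⊥′        = ⊥
  sat w (φ ∧′ ψ)  = sat w φ × sat w ψ
  sat w (φ ∨′ ψ)  = sat w φ ⊎ sat w ψ
  sat w (φ ⇒ ψ)   = ∀ v → w ≼ v → sat v φ → sat v ψ
  sat w (◯ φ)     = sat (S w) φ
  sat w (◇ φ)     = ∃[ k ] sat (iter k w) φ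
  sat w (□ φ)     = ∀ k → sat (iter k w) φ

data ImmSub : Form → Form → Set where
  ∧l : ∀ {φ ψ} → ImmSub φ (φ ∧′ ψ)
  ∧r : ∀ {φ ψ} → ImmSub ψ (φ ∧′ ψ)
  ∨l : ∀ {φ ψ} → ImmSub φ (φ ∨′ ψ)
  ∨r : ∀ {φ ψ} → ImmSub ψ (φ ∨′ ψ)
  ⇒l : ∀ {φ ψ} → ImmSub φ (φ ⇒ ψ)
  ⇒r : ∀ {φ ψ} → ImmSub ψ (φ ⇒ ψ)
  ◯s : ∀ {φ} → ImmSub φ (◯ φ)
  ◇s : ∀ {φ} → ImmSub φ (◇ φ)
  □s : ∀ {φ} → ImmSub φ (□ φ)

SubClosed : List Form → Set
SubClosed Σ′ = ∀ {φ ψ} → ψ ∈ Σ′ → ImmSub φ ψ → φ ∈ Σ′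

-- Labeled posets whose labels are sets of formulas (λ w φ means φ ∈ λ(w)).
record LabeledPoset : Set₁ where
  field
    Carrier : Set
    _≼_     : Carrier → Carrier → Set
    isPO    : IsPartialOrder _≡_ _≼_
    label   : Carrier → Form → Set

Is2^Σ : List Form → LabeledPoset → Set
Is2^Σ Σ′ A = ∀ w φ → LabeledPoset.label A w φ → φ ∈ Σ′

SameLabel : (A B : LabeledPoset) → LabeledPoset.Carrier A → LabeledPoset.Carrier B → Set
SameLabel A B w v = ∀ φ → LabeledPoset.label A w φ ⇔ LabeledPoset.label B v φ

_^_ : IDModel → List Form → LabeledPoset
M ^ Σ′ = record
  { Carrier = IDModel.W M
  ; _≼_     = IDModel._≼_ M
  ; isPO    = IDModel.isPO M
  ; label   = λ w φ → (φ ∈ Σ′) × sat M w φ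
  }

module _ (A B : LabeledPoset) where
  private
    module A = LabeledPoset A
    module B = LabeledPoset B

  IsSimulation : (A.Carrier → B.Carrier → Set) → Set
  IsSimulation σ =
    (∀ w → ∃[ v ] σ w v) ×
    (∀ w v → σ w v →
       SameLabel A B w v ×
       (∀ w′ → w A.≼ w′ → ∃[ v′ ] (v B.≼ v′ × σ w′ v′)))

  IsImmersion : (A.Carrier → B.Carrier) → Set
  IsImmersion f = IsSimulation (λ w v → f w ≡ v)

record Condensation (A B : LabeledPoset) : Set where
  field
    ρ        : LabeledPoset.Carrier A → LabeledPoset.Carrier B
    ι        : LabeledPoset.Carrier B → LabeledPoset.Carrier A
    ρ-imm    : IsImmersion A B ρ
    ι-imm    : IsImmersion B A ι
    ρ-surj   : ∀ b → ∃[ a ] ρ a ≡ b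
    ρι≡id    : ∀ b → ρ (ι b) ≡ b

_≪_[_] : LabeledPoset → IDModel → List Form → Set
A ≪ M [ Σ′ ] = Condensation (M ^ Σ′) A

IsQuasimodel : List Form → LabeledPoset → Set
IsQuasimodel Σ′ A =
  (∀ {w v} → w ≼ v → ∀ φ → label w φ → label v φ) ×
  (∀ φ ψ → (φ ⇒ ψ) ∈ Σ′ → ∀ w →
     label w (φ ⇒ ψ) ⇔ (∀ v → w ≼ v → label v φ → label v ψ))
  where open LabeledPoset A

-- The proof splits into two independent facts.
--  * M^Σ itself is a Σ-quasimodel: labels grow along ≼ because truth in an
--    intuitionistic dynamic model is persistent, and the clause for φ ⇒ ψ is
--    just the Kripke semantics of implication (subformula closure puts φ and
--    ψ into Σ).
--  * Being a Σ-quasimodel transfers along any condensation (ρ , ι) from B to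
--    A.  Both maps are immersions, hence label-preserving and monotone.
--    Monotonicity of A's labels and the "only if" half of the implication
--    clause are pulled back from B through ι; for the "if" half, a witness
--    u ≽ ι w in B is pushed forward by ρ to ρ u ≽ ρ (ι w) = w in A.
-- The theorem is the composition of these two facts.
module Submission where

open import Defs
open import Data.List using (List)
open import Data.List.Membership.Propositional using (_∈_)
open import Data.Nat using (zero; suc)
open import Data.Product using (_×_; _,_; proj₁; proj₂)
open import Data.Sum using (inj₁; inj₂)
open import Function.Bundles using (_⇔_; mk⇔; Equivalence)
open import Relation.Binary.PropositionalEquality using (refl; sym; subst)
open import Relation.Binary.Structures using (IsPartialOrder)

open Equivalence using (to; from)

module Persistence (M : IDModel) where
  open IDModel M

  iter-mono : ∀ k {w v} → w ≼ v → iter M k w ≼ iter M k v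
  iter-mono zero    w≼v = w≼v
  iter-mono (suc k) w≼v = S-mono (iter-mono k w≼v)

  sat-mono : ∀ φ {w v} → w ≼ v → sat M w φ → sat M v φ
  sat-mono (var p)  w≼v s        = V-mono w≼v p s
  sat-mono ⊥′       w≼v ()
  sat-mono (φ ∧′ ψ) w≼v (sφ , sψ) = sat-mono φ w≼v sφ , sat-mono ψ w≼v sψ
  sat-mono (φ ∨′ ψ) w≼v (inj₁ sφ) = inj₁ (sat-mono φ w≼v sφ)
  sat-mono (φ ∨′ ψ) w≼v (inj₂ sψ) = inj₂ (sat-mono ψ w≼v sψ)
  sat-mono (φ ⇒ ψ)  w≼v f        =
    λ u v≼u → f u (IsPartialOrder.trans isPO w≼v v≼u)
  sat-mono (◯ φ)    w≼v s        = sat-mono φ (S-mono w≼v) s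
  sat-mono (◇ φ)    w≼v (k , s)  = k , sat-mono φ (iter-mono k w≼v) s
  sat-mono (□ φ)    w≼v f        = λ k → sat-mono φ (iter-mono k w≼v) (f k)

module Immersion (A B : LabeledPoset)
                 (f : LabeledPoset.Carrier A → LabeledPoset.Carrier B)
                 (f-imm : IsImmersion A B f) where
  private
    module A = LabeledPoset A
    module B = LabeledPoset B

  label-preserved : ∀ w → SameLabel A B w (f w)
  label-preserved w = proj₁ (proj₂ f-imm w (f w) refl)

  -- The simulation clause, specialised to the graph of f, says f w ≼ f w′.
  monotone : ∀ {w w′} → w A.≼ w′ → f w B.≼ f w′
  monotone {w} {w′} w≼w′ with proj₂ (proj₂ f-imm w (f w) refl) w′ w≼w′
  ... | v′ , fw≼v′ , fw′≡v′ = subst (f w B.≼_) (sym fw′≡v′) fw≼v′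

modelQuasimodel : (M : IDModel) (Σ′ : List Form) → SubClosed Σ′ →
                  IsQuasimodel Σ′ (M ^ Σ′)
modelQuasimodel M Σ′ closed = label-mono , implication
  where
  open IDModel M
  open Persistence M

  label-mono : ∀ {w v} → w ≼ v → ∀ φ → (φ ∈ Σ′) × sat M w φ → (φ ∈ Σ′) × sat M v φ
  label-mono w≼v φ (φ∈Σ , s) = φ∈Σ , sat-mono φ w≼v s

  implication : ∀ φ ψ → (φ ⇒ ψ) ∈ Σ′ → ∀ w →
    ((φ ⇒ ψ) ∈ Σ′ × sat M w (φ ⇒ ψ)) ⇔
    (∀ v → w ≼ v → (φ ∈ Σ′) × sat M v φ → (ψ ∈ Σ′) × sat M v ψ)
  implication φ ψ φ⇒ψ∈Σ w = mk⇔
    (λ (_ , f) v w≼v (_ , sφ) → closed φ⇒ψ∈Σ ⇒r , f v w≼v sφ)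
    (λ h → φ⇒ψ∈Σ , λ v w≼v sφ → proj₂ (h v w≼v (closed φ⇒ψ∈Σ ⇒l , sφ)))

condensationQuasimodel : (Σ′ : List Form) (B A : LabeledPoset) →
                         Condensation B A → IsQuasimodel Σ′ B → IsQuasimodel Σ′ A
condensationQuasimodel Σ′ B A C (B-mono , B-implication) = label-mono , implication
  where
  open LabeledPoset A
  module B = LabeledPoset B
  open Condensation C
  module ρ = Immersion B A ρ ρ-imm
  module ι = Immersion A B ι ι-imm

  toB : ∀ {w} φ → label w φ → B.label (ι w) φ
  toB φ = to (ι.label-preserved _ φ)

  fromB : ∀ {w} φ → B.label (ι w) φ → label w φ
  fromB φ = from (ι.label-preserved _ φ)

  label-mono : ∀ {w v} → w ≼ v → ∀ φ → label w φ → label v φ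
  label-mono w≼v φ l = fromB φ (B-mono (ι.monotone w≼v) φ (toB φ l))

  implication : ∀ φ ψ → (φ ⇒ ψ) ∈ Σ′ → ∀ w →
    label w (φ ⇒ ψ) ⇔ (∀ v → w ≼ v → label v φ → label v ψ)
  implication φ ψ φ⇒ψ∈Σ w = mk⇔ only-if if
    where
    clauseB : B.label (ι w) (φ ⇒ ψ) ⇔
              (∀ u → ι w B.≼ u → B.label u φ → B.label u ψ)
    clauseB = B-implication φ ψ φ⇒ψ∈Σ (ι w)

    only-if : label w (φ ⇒ ψ) → ∀ v → w ≼ v → label v φ → label v ψ
    only-if l v w≼v lφ =
      fromB ψ (to clauseB (toB (φ ⇒ ψ) l) (ι v) (ι.monotone w≼v) (toB φ lφ))

    -- A B-successor u of ι w maps under ρ to an A-successor of ρ (ι w) = w.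
    if : (∀ v → w ≼ v → label v φ → label v ψ) → label w (φ ⇒ ψ)
    if h = fromB (φ ⇒ ψ) (from clauseB λ u ιw≼u lφ →
      let w≼ρu = subst (_≼ ρ u) (ρι≡id w) (ρ.monotone ιw≼u)
      in from (ρ.label-preserved u ψ)
           (h (ρ u) w≼ρu (to (ρ.label-preserved u φ) lφ)))

proposition19 : (M : IDModel) (Σ′ : List Form) → SubClosed Σ′ →
    (A : LabeledPoset) → Is2^Σ Σ′ A →
    A ≪ M [ Σ′ ] → IsQuasimodel Σ′ A
proposition19 M Σ′ closed A _ A≪M =
  condensationQuasimodel Σ′ (M ^ Σ′) A A≪M (modelQuasimodel M Σ′ closed)
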